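{- For each $i\in\{2,3,4\}$, the families $\mathrm{SLT}_1$ and $\mathrm{REG}_i^Z$ are incomparable, i.e. neither is a subset of the other.
   Context: For $k\geq1$, a language $L$ over an alphabet $V$ is strictly locally $k$-testable (family $\mathrm{SLT}_k$) if there are sets $B,I,E\subseteq V^k$ and a finite set $F$ of words of length at most $k-1$ such that $L$ consists of the words of $F$ together with exactly those words $a_1a_2\cdots a_n$ ($n\geq k$, $a_i\in V$) for which $a_1\cdots a_k\in B$, $a_{j+1}\cdots a_{j+k}\in I$ for every $j$ with $1\leq j\leq n-k-1$, and $a_{n-k+1}\cdots a_n\in E$. $\mathrm{REG}_n^Z$ is the family of regular languages accepted by some deterministic finite automaton (with total transition function) with at most $n$ states. -}

module Defs where

open import Data.Nat using (ℕ; zero; suc; _+_; _∸_; _≤_)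
open import Data.Fin using (Fin)
open import Data.List using (List; []; _∷_; length; drop; foldl)
open import Data.List.Relation.Unary.All using (All)
open import Data.List.Membership.Propositional using (_∈_)
open import Data.Vec using (Vec; []; _∷_)
open import Data.Maybe using (Maybe; just; nothing)
import Data.Maybe as Maybe
open import Data.Bool using (Bool; T)
open import Data.Empty using (⊥)
open import Data.Product using (Σ; _×_; ∃-syntax)
open import Data.Sum using (_⊎_)
open import Function.Bundles using (_⇔_)
open import Relation.Nullary using (¬_)

Language : ℕ → Set₁
Language m = List (Fin m) → Set

kwin : {A : Set} (k : ℕ) → List A → Maybe (Vec A k)
kwin zero    _        = just []
kwin (suc k) []       = nothing
kwin (suc k) (x ∷ xs) = Maybe.map (x ∷_) (kwin k xs)

InSet : {A : Set} {k : ℕ} → (Vec A k → Bool) → Maybe (Vec A k) → Set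
InSet P nothing  = ⊥
InSet P (just v) = T (P v)

-- For w = a_1 ... a_n: n ≥ k, a_1..a_k ∈ B, a_{j+1}..a_{j+k} ∈ I for
-- 1 ≤ j ≤ n-k-1 (i.e. j+k+1 ≤ n), and a_{n-k+1}..a_n ∈ E.
SLTWord : {A : Set} (k : ℕ) (B I E : Vec A k → Bool) → List A → Set
SLTWord k B I E w =
  k ≤ length w
  × InSet B (kwin k w)
  × (∀ j → 1 ≤ j → j + k + 1 ≤ length w → InSet I (kwin k (drop j w)))
  × InSet E (kwin k (drop (length w ∸ k) w))

-- Strictly locally k-testable languages. Subsets of V^k are Boolean
-- predicates on Vec (Fin m) k; F is a finite list of words of length ≤ k-1.
SLT : ℕ → {m : ℕ} → Language m → Set
SLT k {m} L =
  Σ (Vec (Fin m) k → Bool) λ B →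
  Σ (Vec (Fin m) k → Bool) λ I →
  Σ (Vec (Fin m) k → Bool) λ E →
  Σ (List (List (Fin m))) λ F →
    All (λ u → length u + 1 ≤ k) F
    × (∀ w → L w ⇔ (w ∈ F ⊎ SLTWord k B I E w))

record DFA (m : ℕ) : Set where
  field
    states : ℕ
    δ      : Fin states → Fin m → Fin states
    q₀     : Fin states
    final  : Fin states → Bool

accepts : {m : ℕ} → DFA m → List (Fin m) → Bool
accepts A w = DFA.final A (foldl (DFA.δ A) (DFA.q₀ A) w)

REGZ : ℕ → {m : ℕ} → Language m → Set
REGZ n {m} L =
  Σ (DFA m) λ A → DFA.states A ≤ n × (∀ w → L w ⇔ T (accepts A w))

_⊆F_ : (∀ {m} → Language m → Set) → (∀ {m} → Language m → Set) → Set₁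
𝓕 ⊆F 𝓖 = ∀ {m} (L : Language m) → 𝓕 L → 𝓖 L

Incomparable : (∀ {m} → Language m → Set) → (∀ {m} → Language m → Set) → Set₁
Incomparable 𝓕 𝓖 = ¬ (𝓕 ⊆F 𝓖) × ¬ (𝓖 ⊆F 𝓕)

{-# OPTIONS --safe #-}
-- The language of nonempty words over {a, b, c} that do not begin with c, do
-- not end with b and have no interior c is SLT₁, and its prefixes ε, a, b, ac,
-- c are pairwise distinguishable in the sense of Myhill–Nerode, so by the
-- pigeonhole principle no DFA with at most four states accepts it.
-- Conversely, an SLT₁ condition only sees the first, last and interior letters
-- of a word, so deleting an interior letter of a word of length at least three
-- preserves membership; the two-state language of even-length words over a
-- one-letter alphabet is therefore not SLT₁.
module Submission where

open import Defs
open import Data.Nat using (ℕ; zero; suc; _+_; _∸_; _≤_; _<_; z≤n; s≤s)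
open import Data.Nat.Properties
  using (≤-refl; ≤-trans; +-comm; +-assoc; m≤n+m; 1+n≰n; module ≤-Reasoning)
open import Data.Fin as Fin using (Fin; zero; suc)
open import Data.Fin.Properties using (pigeonhole)
open import Data.List using (List; []; _∷_; _++_; foldl; length; lookup; drop)
open import Data.List.Properties using (foldl-++)
open import Data.List.Membership.Propositional.Properties using (∈-lookup)
open import Data.List.Relation.Unary.All as All using ([]; _∷_)
open import Data.List.Relation.Unary.AllPairs using (AllPairs; []; _∷_)
open import Data.Vec using (Vec; []; _∷_)
open import Data.Bool using (Bool; true; false; T)
open import Data.Unit using (tt)
open import Data.Empty using (⊥-elim)
open import Data.Product using (_×_; _,_; ∃-syntax)
open import Data.Sum using (_⊎_; inj₁; inj₂; [_,_])
open import Function using (id)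
open import Function.Bundles using (_⇔_; mk⇔; module Equivalence)
open import Relation.Binary.Core using (Rel)
open import Relation.Nullary using (¬_)
open import Relation.Binary.PropositionalEquality
  using (_≡_; _≢_; cong; subst; sym; module ≡-Reasoning)

open Equivalence using (to; from)

module _ {a ℓ} {A : Set a} {R : Rel A ℓ} where

  AllPairs-lookup : ∀ {xs} → AllPairs R xs →
                    ∀ {i j : Fin (length xs)} → i Fin.< j →
                    R (lookup xs i) (lookup xs j)
  AllPairs-lookup (Rx ∷ _)    {zero}  {suc j} _         = All.lookup Rx (∈-lookup j)
  AllPairs-lookup (_  ∷ Rxs) {suc i} {suc j} (s≤s i<j) = AllPairs-lookup Rxs i<j

Distinguishable : ∀ {m} → Language m → List (Fin m) → List (Fin m) → Set
Distinguishable L u v =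
  ∃[ s ] (L (u ++ s) × ¬ L (v ++ s) ⊎ ¬ L (u ++ s) × L (v ++ s))

run : ∀ {m} (A : DFA m) → List (Fin m) → Fin (DFA.states A)
run A = foldl (DFA.δ A) (DFA.q₀ A)

module _ {m} (A : DFA m) where
  open DFA A

  accepts-++-cong : ∀ {u v} s → run A u ≡ run A v →
                    accepts A (u ++ s) ≡ accepts A (v ++ s)
  accepts-++-cong {u} {v} s eq = begin
    final (foldl δ q₀ (u ++ s))     ≡⟨ cong final (foldl-++ δ q₀ u s) ⟩
    final (foldl δ (run A u) s)     ≡⟨ cong (λ q → final (foldl δ q s)) eq ⟩
    final (foldl δ (run A v) s)     ≡⟨ cong final (foldl-++ δ q₀ v s) ⟨
    final (foldl δ q₀ (v ++ s))     ∎
    where open ≡-Reasoning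

  distinguishable⇒run≢ : ∀ {L : Language m} → (∀ w → L w ⇔ T (accepts A w)) →
                         ∀ {u v} → Distinguishable L u v → run A u ≢ run A v
  distinguishable⇒run≢ L⇔A {u} {v} (s , inj₁ (Lus , ¬Lvs)) eq =
    ¬Lvs (from (L⇔A _) (subst T (accepts-++-cong {u} {v} s eq) (to (L⇔A _) Lus)))
  distinguishable⇒run≢ L⇔A {u} {v} (s , inj₂ (¬Lus , Lvs)) eq =
    ¬Lus (from (L⇔A _) (subst T (sym (accepts-++-cong {u} {v} s eq)) (to (L⇔A _) Lvs)))

distinguishable⇒¬REGZ : ∀ {n m} {L : Language m} (ws : List (List (Fin m))) →
                        AllPairs (Distinguishable L) ws → n < length ws → ¬ REGZ n L
distinguishable⇒¬REGZ ws dist n<∣ws∣ (A , states≤n , L⇔A)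
  with i , j , i<j , eq ← pigeonhole (≤-trans (s≤s states≤n) n<∣ws∣) (λ i → run A (lookup ws i))
  = distinguishable⇒run≢ A L⇔A (AllPairs-lookup dist i<j) eq

interior-needs-length : ∀ {j k n} → 1 ≤ j → j + k + 1 ≤ n → 2 + k ≤ n
interior-needs-length {suc j} {k} {n} _ j+k+1≤n = begin
  2 + k               ≡⟨ cong suc (+-comm 1 k) ⟩
  suc (k + 1)         ≤⟨ s≤s (m≤n+m (k + 1) j) ⟩
  suc (j + (k + 1))   ≡⟨ cong suc (+-assoc j k 1) ⟨
  suc j + k + 1       ≤⟨ j+k+1≤n ⟩
  n                   ∎
  where open ≤-Reasoning

SLTWord-short : ∀ {A : Set} {k} {B I E : Vec A k → Bool} (w : List A) →
                k ≤ length w → length w ≤ suc k →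
                InSet B (kwin k w) → InSet E (kwin k (drop (length w ∸ k) w)) →
                SLTWord k B I E w
SLTWord-short {k = k} {I = I} w k≤∣w∣ ∣w∣≤1+k inB inE = k≤∣w∣ , inB , noInterior , inE
  where
  noInterior : ∀ j → 1 ≤ j → j + k + 1 ≤ length w → InSet I (kwin k (drop j w))
  noInterior j 1≤j j+k+1≤∣w∣ =
    ⊥-elim (1+n≰n (≤-trans (interior-needs-length 1≤j j+k+1≤∣w∣) ∣w∣≤1+k))

-- The interior factors of x ∷ z ∷ w are those of x ∷ y ∷ z ∷ w shifted by one,
-- and both words have the same last letter, definitionally.
SLTWord₁-deleteSecond : ∀ {A : Set} {B I E : Vec A 1 → Bool} x y z w →
                        SLTWord 1 B I E (x ∷ y ∷ z ∷ w) → SLTWord 1 B I E (x ∷ z ∷ w)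
SLTWord₁-deleteSecond {I = I} x y z w (_ , inB , inI , inE) = s≤s z≤n , inB , inI′ , inE
  where
  inI′ : ∀ j → 1 ≤ j → j + 1 + 1 ≤ length (x ∷ z ∷ w) → InSet I (kwin 1 (drop j (x ∷ z ∷ w)))
  inI′ (suc j) _ in-bounds = inI (suc (suc j)) (s≤s z≤n) (s≤s in-bounds)

SLT₁-deleteSecond : ∀ {m} {L : Language m} → SLT 1 L →
                    ∀ x y z w → L (x ∷ y ∷ z ∷ w) → L (x ∷ z ∷ w)
SLT₁-deleteSecond (B , I , E , F , F-short , L⇔) x y z w L-xyzw
  with to (L⇔ _) L-xyzw
... | inj₁ xyzw∈F with s≤s () ← All.lookup F-short xyzw∈F
... | inj₂ slt = from (L⇔ _) (inj₂ (SLTWord₁-deleteSecond {B = B} {I} {E} x y z w slt))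

pattern a = zero
pattern b = suc zero
pattern c = suc (suc zero)

notB notC : Vec (Fin 3) 1 → Bool
notB (b ∷ []) = false
notB _        = true
notC (c ∷ []) = false
notC _        = true

L₅ : Language 3
L₅ = SLTWord 1 notC notC notB

L₅-SLT₁ : SLT 1 L₅
L₅-SLT₁ = notC , notC , notB , [] , [] , λ w → mk⇔ inj₂ [ (λ ()) , id ]

L₅-length₁ : ∀ x → T (notC (x ∷ [])) → T (notB (x ∷ [])) → L₅ (x ∷ [])
L₅-length₁ x = SLTWord-short {B = notC} {notC} {notB} (x ∷ []) (s≤s z≤n) (s≤s z≤n)

L₅-length₂ : ∀ x y → T (notC (x ∷ [])) → T (notB (y ∷ [])) → L₅ (x ∷ y ∷ [])
L₅-length₂ x y = SLTWord-short {B = notC} {notC} {notB} (x ∷ y ∷ []) (s≤s z≤n) ≤-refl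

ε∉L₅ : ¬ L₅ []
ε∉L₅ (() , _)

c∷w∉L₅ : ∀ w → ¬ L₅ (c ∷ w)
c∷w∉L₅ w (_ , () , _)

b∉L₅ : ¬ L₅ (b ∷ [])
b∉L₅ (_ , _ , _ , ())

aca∉L₅ : ¬ L₅ (a ∷ c ∷ a ∷ [])
aca∉L₅ (_ , _ , inI , _) with () ← inI 1 (s≤s z≤n) ≤-refl

L₅-prefixes : List (List (Fin 3))
L₅-prefixes = [] ∷ (a ∷ []) ∷ (b ∷ []) ∷ (a ∷ c ∷ []) ∷ (c ∷ []) ∷ []

L₅-prefixes-distinguishable : AllPairs (Distinguishable L₅) L₅-prefixes
L₅-prefixes-distinguishable =
    (([] , inj₂ (ε∉L₅ , L₅-length₁ a tt tt))
   ∷ ((c ∷ []) , inj₂ (c∷w∉L₅ [] , L₅-length₂ b c tt tt))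
   ∷ ([] , inj₂ (ε∉L₅ , L₅-length₂ a c tt tt))
   ∷ ((a ∷ []) , inj₁ (L₅-length₁ a tt tt , c∷w∉L₅ (a ∷ [])))
   ∷ [])
  ∷ (([] , inj₁ (L₅-length₁ a tt tt , b∉L₅))
   ∷ ((a ∷ []) , inj₁ (L₅-length₂ a a tt tt , aca∉L₅))
   ∷ ([] , inj₁ (L₅-length₁ a tt tt , c∷w∉L₅ []))
   ∷ [])
  ∷ (([] , inj₂ (b∉L₅ , L₅-length₂ a c tt tt))
   ∷ ((a ∷ []) , inj₁ (L₅-length₂ b a tt tt , c∷w∉L₅ (a ∷ [])))
   ∷ [])
  ∷ (([] , inj₁ (L₅-length₂ a c tt tt , c∷w∉L₅ [])) ∷ [])
  ∷ []
  ∷ []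

SLT₁⊈REGZ : ∀ {n} → n ≤ 4 → ¬ (SLT 1 ⊆F REGZ n)
SLT₁⊈REGZ n≤4 SLT₁⊆REGZ =
  distinguishable⇒¬REGZ L₅-prefixes L₅-prefixes-distinguishable (s≤s n≤4)
    (SLT₁⊆REGZ L₅ L₅-SLT₁)

parity : DFA 1
parity = record
  { states = 2
  ; δ      = λ { zero _ → suc zero ; (suc zero) _ → zero }
  ; q₀     = zero
  ; final  = λ { zero → true ; (suc zero) → false }
  }

Even : Language 1
Even w = T (accepts parity w)

REGZ⊈SLT₁ : ∀ {n} → 2 ≤ n → ¬ (REGZ n ⊆F SLT 1)
REGZ⊈SLT₁ 2≤n REGZ⊆SLT₁ =
  SLT₁-deleteSecond (REGZ⊆SLT₁ Even (parity , 2≤n , λ w → mk⇔ id id))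
    zero zero zero (zero ∷ []) tt

lemma11 : (i : ℕ) → 2 ≤ i → i ≤ 4 → Incomparable (SLT 1) (REGZ i)
lemma11 i 2≤i i≤4 = SLT₁⊈REGZ i≤4 , REGZ⊈SLT₁ 2≤i
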